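{- Let $\mathcal T$ be an extensional typed combinatory algebra, let $(X,A,\alpha)$ be a strongly modest assembly and $(Y,B,\beta)$ a modest exhaustive assembly over $\mathcal T$. If $f\in|A\to B|$, then there is a unique morphism of assemblies $\bar f:(X,A,\alpha)\to(Y,B,\beta)$ tracked by $f$.
   Context: A typed combinatory algebra (tca) $\mathcal{T}$ consists of a set of types containing $\bot,\top,N$ and closed under $\times,\to,+$; sets $|T|$; total application maps $|S\to T|\times|S|\to|T|$, $(a,b)\mapsto ab$; and elements $\mathsf{exf},\mathsf t,\mathsf k,\mathsf s,\mathsf{pair},\mathsf{fst},\mathsf{snd},\mathsf{inl},\mathsf{inr},\mathsf{case},\mathsf 0,\mathsf{succ},\mathsf R$ satisfying the usual combinator, pairing, case and recursion equations. $\mathcal T$ is extensional if the maps $|S\times T|\to|S|\times|T|$, $x\mapsto(\mathsf{fst}x,\mathsf{snd}x)$ and $|T\to S|\to|S|^{|T|}$, $x\mapsto(y\mapsto xy)$ are injective and $|\top|=\{\mathsf t\}$. An assembly is $(X,A,\alpha)$ with $X$ a set, $A$ a type, $\alpha(x)\subseteq|A|$ inhabited; a morphism $(X,A,\alpha)\to(Y,B,\beta)$ is a function $g:X\to Y$ tracked by some $e\in|A\to B|$, meaning $a\in\alpha(x)\Rightarrow ea\in\beta(g(x))$. An assembly is modest if $a\in\alpha(x)\cap\alpha(y)$ implies $x=y$; strongly modest if moreover each $\alpha(x)$ is a singleton; exhaustive if every $a\in|A|$ lies in some $\alpha(x)$. -}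

module Defs where

open import Data.Product using (Σ; _×_; _,_)
open import Relation.Binary.PropositionalEquality using (_≡_)

record TCA : Set₁ where
  infixr 6 _⇒_
  infixr 7 _⊗_
  infixr 7 _⊕_
  infixl 9 _·_
  field
    Ty  : Set
    ⊥ᵗ ⊤ᵗ Nᵗ : Ty
    _⊗_ _⇒_ _⊕_ : Ty → Ty → Ty
    ∣_∣ : Ty → Set
    _·_ : {S T : Ty} → ∣ S ⇒ T ∣ → ∣ S ∣ → ∣ T ∣
    exf  : {T : Ty} → ∣ ⊥ᵗ ⇒ T ∣
    t    : ∣ ⊤ᵗ ∣
    k    : {S T : Ty} → ∣ S ⇒ T ⇒ S ∣
    s    : {R S T : Ty} → ∣ (R ⇒ S ⇒ T) ⇒ (R ⇒ S) ⇒ R ⇒ T ∣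
    pair : {S T : Ty} → ∣ S ⇒ T ⇒ S ⊗ T ∣
    fst  : {S T : Ty} → ∣ S ⊗ T ⇒ S ∣
    snd  : {S T : Ty} → ∣ S ⊗ T ⇒ T ∣
    inl  : {S T : Ty} → ∣ S ⇒ S ⊕ T ∣
    inr  : {S T : Ty} → ∣ T ⇒ S ⊕ T ∣
    case : {S T R : Ty} → ∣ (S ⇒ R) ⇒ (T ⇒ R) ⇒ S ⊕ T ⇒ R ∣
    zero : ∣ Nᵗ ∣
    succ : ∣ Nᵗ ⇒ Nᵗ ∣
    rec  : {T : Ty} → ∣ T ⇒ (Nᵗ ⇒ T ⇒ T) ⇒ Nᵗ ⇒ T ∣
    k-eq    : {S T : Ty} (a : ∣ S ∣) (b : ∣ T ∣) → k · a · b ≡ a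
    s-eq    : {R S T : Ty} (a : ∣ R ⇒ S ⇒ T ∣) (b : ∣ R ⇒ S ∣) (c : ∣ R ∣) →
              s · a · b · c ≡ a · c · (b · c)
    fst-eq  : {S T : Ty} (a : ∣ S ∣) (b : ∣ T ∣) → fst · (pair · a · b) ≡ a
    snd-eq  : {S T : Ty} (a : ∣ S ∣) (b : ∣ T ∣) → snd · (pair · a · b) ≡ b
    case-inl : {S T R : Ty} (a : ∣ S ⇒ R ∣) (b : ∣ T ⇒ R ∣) (c : ∣ S ∣) →
               case · a · b · (inl {S} {T} · c) ≡ a · c
    case-inr : {S T R : Ty} (a : ∣ S ⇒ R ∣) (b : ∣ T ⇒ R ∣) (c : ∣ T ∣) →
               case · a · b · (inr {S} {T} · c) ≡ b · c
    rec-zero : {T : Ty} (a : ∣ T ∣) (b : ∣ Nᵗ ⇒ T ⇒ T ∣) → rec · a · b · zero ≡ a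
    rec-succ : {T : Ty} (a : ∣ T ∣) (b : ∣ Nᵗ ⇒ T ⇒ T ∣) (n : ∣ Nᵗ ∣) →
               rec · a · b · (succ · n) ≡ b · n · (rec · a · b · n)

module _ (𝒯 : TCA) where
  open TCA 𝒯

  record Extensional : Set where
    field
      pair-inj : {S T : Ty} (x y : ∣ S ⊗ T ∣) →
                 fst · x ≡ fst · y → snd · x ≡ snd · y → x ≡ y
      app-inj  : {S T : Ty} (x y : ∣ T ⇒ S ∣) →
                 ((z : ∣ T ∣) → x · z ≡ y · z) → x ≡ y
      top-t    : (a : ∣ ⊤ᵗ ∣) → a ≡ t

  record Assembly : Set₁ where
    field
      X    : Set
      A    : Ty
      α    : X → ∣ A ∣ → Set
      inhabited : (x : X) → Σ ∣ A ∣ (λ a → α x a)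

  open Assembly

  TrackedBy : (𝒳 𝒴 : Assembly) → (X 𝒳 → X 𝒴) → ∣ A 𝒳 ⇒ A 𝒴 ∣ → Set
  TrackedBy 𝒳 𝒴 g e = (x : X 𝒳) (a : ∣ A 𝒳 ∣) → α 𝒳 x a → α 𝒴 (g x) (e · a)

  record Morphism (𝒳 𝒴 : Assembly) : Set where
    field
      fun     : X 𝒳 → X 𝒴
      tracker : ∣ A 𝒳 ⇒ A 𝒴 ∣
      tracks  : TrackedBy 𝒳 𝒴 fun tracker

  Modest : Assembly → Set
  Modest 𝒳 = (x y : X 𝒳) (a : ∣ A 𝒳 ∣) → α 𝒳 x a → α 𝒳 y a → x ≡ y

  StronglyModest : Assembly → Set
  StronglyModest 𝒳 = Modest 𝒳 ×
    ((x : X 𝒳) (a b : ∣ A 𝒳 ∣) → α 𝒳 x a → α 𝒳 x b → a ≡ b)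

  Exhaustive : Assembly → Set
  Exhaustive 𝒳 = (a : ∣ A 𝒳 ∣) → Σ (X 𝒳) (λ x → α 𝒳 x a)

{-# OPTIONS --safe #-}
-- A realizer a of x is sent by f to a realizer of exactly one element of 𝒴
-- (exhaustive: at least one; modest: at most one); since x has only one
-- realizer this defines f̄ x, and modesty of 𝒴 forces every morphism tracked
-- by f to agree with it.
module Submission where

open import Defs
open import Data.Product using (Σ; _×_; _,_; proj₁; proj₂)
open import Relation.Binary.PropositionalEquality using (_≡_; refl; subst)

module _ (𝒯 : TCA) where
  open TCA 𝒯
  open Assembly

  HasUniqueRealizers : Assembly 𝒯 → Set
  HasUniqueRealizers 𝒳 = (x : X 𝒳) (a b : ∣ A 𝒳 ∣) → α 𝒳 x a → α 𝒳 x b → a ≡ b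

  trackedBy-unique : (𝒳 𝒴 : Assembly 𝒯) → Modest 𝒯 𝒴 →
    {g h : X 𝒳 → X 𝒴} {e : ∣ A 𝒳 ⇒ A 𝒴 ∣} →
    TrackedBy 𝒯 𝒳 𝒴 g e → TrackedBy 𝒯 𝒳 𝒴 h e → (x : X 𝒳) → g x ≡ h x
  trackedBy-unique 𝒳 𝒴 modest g-tracked h-tracked x =
    let a , a⊩x = inhabited 𝒳 x
    in modest _ _ _ (g-tracked x a a⊩x) (h-tracked x a a⊩x)

  inducedMorphism : (𝒳 𝒴 : Assembly 𝒯) → HasUniqueRealizers 𝒳 → Exhaustive 𝒯 𝒴 →
    ∣ A 𝒳 ⇒ A 𝒴 ∣ → Morphism 𝒯 𝒳 𝒴
  inducedMorphism 𝒳 𝒴 unique exhaustive e = record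
    { fun = f̄ ; tracker = e ; tracks = f̄-tracked }
    where
    realizer : X 𝒳 → ∣ A 𝒳 ∣
    realizer x = proj₁ (inhabited 𝒳 x)

    f̄ : X 𝒳 → X 𝒴
    f̄ x = proj₁ (exhaustive (e · realizer x))

    f̄-tracked : TrackedBy 𝒯 𝒳 𝒴 f̄ e
    f̄-tracked x a a⊩x =
      subst (λ b → α 𝒴 (f̄ x) (e · b))
            (unique x (realizer x) a (proj₂ (inhabited 𝒳 x)) a⊩x)
            (proj₂ (exhaustive (e · realizer x)))

mainTheorem15 : (𝒯 : TCA) → Extensional 𝒯 →
    (𝒳 𝒴 : Assembly 𝒯) → StronglyModest 𝒯 𝒳 → Modest 𝒯 𝒴 → Exhaustive 𝒯 𝒴 →
    (f : TCA.∣_∣ 𝒯 (TCA._⇒_ 𝒯 (Assembly.A 𝒳) (Assembly.A 𝒴))) →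
    Σ (Morphism 𝒯 𝒳 𝒴) (λ m → (Morphism.tracker m ≡ f) ×
      ((m′ : Morphism 𝒯 𝒳 𝒴) → Morphism.tracker m′ ≡ f →
        (x : Assembly.X 𝒳) → Morphism.fun m′ x ≡ Morphism.fun m x))
mainTheorem15 𝒯 _ 𝒳 𝒴 (_ , unique) modest exhaustive f =
  f̄ , refl , f̄-unique
  where
  f̄ : Morphism 𝒯 𝒳 𝒴
  f̄ = inducedMorphism 𝒯 𝒳 𝒴 unique exhaustive f

  f̄-unique : (m′ : Morphism 𝒯 𝒳 𝒴) → Morphism.tracker m′ ≡ f →
    (x : Assembly.X 𝒳) → Morphism.fun m′ x ≡ Morphism.fun f̄ x
  f̄-unique m′ refl =
    trackedBy-unique 𝒯 𝒳 𝒴 modest (Morphism.tracks m′) (Morphism.tracks f̄)
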